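{- Let $A=\{0,1,\dots,m\}$ with $m\ge 1$ and let $\ell\ge 2$. The lexicographically largest Nyldon word of length at most $\ell$ is $m(m-1)m^{\ell-2}$, i.e. the letter $m$, then the letter $m-1$, then $\ell-2$ copies of $m$.
   Context: $A=\{0,1,\dots,m\}$ is ordered $0<1<\cdots<m$. The lexicographic order $<_{\text{lex}}$ on $A^*$: $u<_{\text{lex}}v$ if $u$ is a proper prefix of $v$, or there are a word $p$ and letters $i<j$ with $pi$ a prefix of $u$ and $pj$ a prefix of $v$. Nyldon words are defined recursively: a nonempty word $w$ is Nyldon if $w$ is a single letter, or $w$ cannot be written as $w=w_1w_2\cdots w_k$ with $k\ge 2$, each $w_i$ Nyldon, and $w_1\le_{\text{lex}}w_2\le_{\text{lex}}\cdots\le_{\text{lex}}w_k$. -}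

module Defs where

open import Data.Nat using (ℕ; zero; suc; _≤_)
open import Data.Fin using (Fin) renaming (_<_ to _<ᶠ_)
open import Data.List using (List; []; _∷_; length; concat)
open import Data.List.Relation.Unary.All using (All)
open import Data.List.Relation.Unary.Linked using (Linked)
open import Data.Product using (Σ; _×_)
open import Data.Sum using (_⊎_)
open import Data.Empty using (⊥)
open import Data.Unit using (⊤)
open import Relation.Nullary using (¬_)
open import Relation.Binary.PropositionalEquality using (_≡_)

Word : ℕ → Set
Word m = List (Fin (suc m))

data _<lex_ {m : ℕ} : Word m → Word m → Set where
  prefix : ∀ {a v} → [] <lex (a ∷ v)
  here   : ∀ {i j u v} → i <ᶠ j → (i ∷ u) <lex (j ∷ v)
  there  : ∀ {a u v} → u <lex v → (a ∷ u) <lex (a ∷ v)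

_≤lex_ : {m : ℕ} → Word m → Word m → Set
u ≤lex v = u ≡ v ⊎ u <lex v

-- The recursion is on a
-- fuel parameter n; every factor in a factorization into k ≥ 2 nonempty words
-- is strictly shorter than w, so fuel = length w suffices (and is used below).
NyldonF : {m : ℕ} → ℕ → Word m → Set
NyldonF zero _ = ⊥
NyldonF (suc n) [] = ⊥
NyldonF (suc n) (a ∷ []) = ⊤
NyldonF {m} (suc n) w@(a ∷ b ∷ rest) =
  ¬ (Σ (List (Word m)) λ ws →
       (2 ≤ length ws) × (concat ws ≡ w) × All (NyldonF n) ws × Linked _≤lex_ ws)

Nyldon : {m : ℕ} → Word m → Set
Nyldon w = NyldonF (length w) w

module Submission where

-- A word a b u with a ≤ b is never Nyldon: prepending the factor a to a sorted
-- Nyldon factorisation of b u factorises a b u, so b u is Nyldon too, and then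
-- a · (b u) is itself a sorted Nyldon factorisation. So the second letter of a
-- Nyldon word lies strictly below the first, which bounds every Nyldon word of
-- length ≤ ℓ by m (m-1) m^(ℓ-2). This word is Nyldon: in a sorted factorisation
-- the first factor is either the letter m, greater than the letter m-1 starting
-- the second factor, or it is longer, while the second factor is a constant
-- Nyldon word, hence the single letter m, which is lexicographically smaller.

open import Defs
open import Data.Nat using (ℕ; suc; _≤_)
open import Data.Fin using (fromℕ; inject₁)
open import Data.List using (_∷_; replicate; length)
open import Data.Product using (_×_)

open import Data.Nat using (z≤n; s≤s; _<_)
open import Data.Nat.Properties using (≤-refl; ≤-trans; <-≤-trans; ≤-<-trans; <⇒≤; ≤-pred; n≤1+n; m<m+n; m<n+m; ≤-reflexive; ≰⇒>; <⇒≱; <-irrefl)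
open import Data.Fin using (Fin) renaming (_≤_ to _≤ᶠ_; _<_ to _<ᶠ_; _≤?_ to _≤ᶠ?_)
open import Data.Fin.Properties using (_≟_; ≤fromℕ; fromℕ≢inject₁; ≤∧≢⇒<; <⇒≤pred)
open import Data.List using (List; []; _++_; concat)
open import Data.List.Properties using (++-identityʳ; length-replicate; length-++; length-++-≤ˡ; length-++-≤ʳ; ∷-injectiveˡ; ∷-injectiveʳ)
open import Data.List.Relation.Unary.All as All using (All; []; _∷_)
open import Data.List.Relation.Unary.All.Properties using (++⁻ˡ; ++⁻ʳ; replicate⁺)
open import Data.List.Relation.Unary.Linked using (Linked; [-]; _∷_)
open import Data.Product using (∃; _,_; uncurry)
open import Data.Sum using (inj₁; inj₂)
open import Data.Empty using (⊥-elim)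
open import Data.Unit using (tt)
open import Relation.Nullary using (¬_; yes; no)
open import Function using (_∘_)
open import Relation.Binary.PropositionalEquality using (_≡_; refl; sym; cong; subst)

module _ {m : ℕ} where

  SortedFactorisation : (Word m → Set) → Word m → List (Word m) → Set
  SortedFactorisation P w ws =
    (2 ≤ length ws) × (concat ws ≡ w) × All P ws × Linked _≤lex_ ws

  NyldonF-nonempty : ∀ {n} {u : Word m} → NyldonF n u → 0 < length u
  NyldonF-nonempty {suc n} {a ∷ u} _ = s≤s z≤n

  concat-factor-≤ : (ws : List (Word m)) → All (λ u → length u ≤ length (concat ws)) ws
  concat-factor-≤ [] = []
  concat-factor-≤ (u ∷ ws) =
    length-++-≤ˡ u ∷ All.map (λ le → ≤-trans le (length-++-≤ʳ (concat ws) {u})) (concat-factor-≤ ws)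

  concat-factor-< : (ws : List (Word m)) → 2 ≤ length ws → All (λ u → 0 < length u) ws
                  → All (λ u → length u < length (concat ws)) ws
  concat-factor-< (_ ∷ []) (s≤s ()) _
  concat-factor-< (u ∷ v ∷ ws) _ (0<u ∷ 0<v ∷ _) =
    subst (length u <_) (sym (length-++ u)) (m<m+n (length u) (<-≤-trans 0<v (length-++-≤ˡ v)))
    ∷ All.map (λ le → ≤-<-trans le (subst (length rest <_) (sym (length-++ u)) (m<n+m (length rest) 0<u)))
              (concat-factor-≤ (v ∷ ws))
    where rest = concat (v ∷ ws)

  SortedFactorisation-map : ∀ {P Q : Word m → Set} {w ws}
    → (∀ {u} → P u → 0 < length u) → (∀ {u} → length u < length w → P u → Q u)
    → SortedFactorisation P w ws → SortedFactorisation Q w ws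
  SortedFactorisation-map {ws = ws} nonempty P⇒Q (2≤ , refl , Ps , sorted) =
    2≤ , refl , All.zipWith (uncurry P⇒Q) (concat-factor-< ws 2≤ (All.map nonempty Ps) , Ps) , sorted

  NyldonF-fuel : ∀ {n n′} (w : Word m) → length w ≤ n → length w ≤ n′ → NyldonF n w → NyldonF n′ w
  NyldonF-fuel {suc n} {suc n′} (a ∷ []) _ _ _ = tt
  NyldonF-fuel {suc n} {suc n′} (a ∷ b ∷ u) w≤n w≤n′ ν (ws , factorisation) =
    ν (ws , SortedFactorisation-map NyldonF-nonempty
              (λ {v} v<w → NyldonF-fuel {n′} {n} v (≤-pred (<-≤-trans v<w w≤n′)) (≤-pred (<-≤-trans v<w w≤n)))
              factorisation)

  NyldonF⇒Nyldon : ∀ {n} (w : Word m) → length w ≤ n → NyldonF n w → Nyldon w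
  NyldonF⇒Nyldon w w≤n = NyldonF-fuel w w≤n ≤-refl

  Nyldon⇒NyldonF : ∀ {n} (w : Word m) → length w ≤ n → Nyldon w → NyldonF n w
  Nyldon⇒NyldonF w w≤n = NyldonF-fuel w ≤-refl w≤n

  Factorisable : Word m → Set
  Factorisable w = ∃ (SortedFactorisation Nyldon w)

  Nyldon⇒¬Factorisable : ∀ {a b} {u : Word m} → Nyldon (a ∷ b ∷ u) → ¬ Factorisable (a ∷ b ∷ u)
  Nyldon⇒¬Factorisable ν (ws , factorisation) =
    ν (ws , SortedFactorisation-map NyldonF-nonempty
              (λ {v} v<w → Nyldon⇒NyldonF v (≤-pred v<w)) factorisation)

  ¬Factorisable⇒Nyldon : ∀ {a b} {u : Word m} → ¬ Factorisable (a ∷ b ∷ u) → Nyldon (a ∷ b ∷ u)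
  ¬Factorisable⇒Nyldon ¬factorisable (ws , factorisation) =
    ¬factorisable (ws , SortedFactorisation-map NyldonF-nonempty
                          (λ {v} v<w → NyldonF⇒Nyldon v (≤-pred v<w)) factorisation)

  []-≤lex : (v : Word m) → [] ≤lex v
  []-≤lex [] = inj₁ refl
  []-≤lex (_ ∷ _) = inj₂ prefix

  ∷-mono-≤lex : ∀ {a b} {u v : Word m} → a ≤ᶠ b → u ≤lex v → (a ∷ u) ≤lex (b ∷ v)
  ∷-mono-≤lex {a} {b} a≤b u≤v with a ≟ b | u≤v
  ... | no a≢b | _ = inj₂ (here (≤∧≢⇒< a≤b a≢b))
  ... | yes refl | inj₁ refl = inj₁ refl
  ... | yes refl | inj₂ u<v = inj₂ (there u<v)

  [-]-≤lex⇒≤ : ∀ {a b} {v : Word m} → (a ∷ []) ≤lex (b ∷ v) → a ≤ᶠ b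
  [-]-≤lex⇒≤ (inj₁ refl) = ≤-refl
  [-]-≤lex⇒≤ (inj₂ (here a<b)) = <⇒≤ a<b
  [-]-≤lex⇒≤ (inj₂ (there _)) = ≤-refl

  ≤lex-[-]⇒≡[] : ∀ {a} {u : Word m} → (a ∷ u) ≤lex (a ∷ []) → u ≡ []
  ≤lex-[-]⇒≡[] (inj₁ refl) = refl
  ≤lex-[-]⇒≡[] (inj₂ (here a<a)) = ⊥-elim (<-irrefl refl a<a)

  ≤lex-replicate-fromℕ : ∀ j (u : Word m) → length u ≤ j → u ≤lex replicate j (fromℕ m)
  ≤lex-replicate-fromℕ j [] _ = []-≤lex _
  ≤lex-replicate-fromℕ (suc j) (a ∷ u) (s≤s u≤j) =
    ∷-mono-≤lex (≤fromℕ a) (≤lex-replicate-fromℕ j u u≤j)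

  Factorisable-∷ : ∀ {a b} {u : Word m} → a ≤ᶠ b → Factorisable (b ∷ u) → Factorisable (a ∷ b ∷ u)
  Factorisable-∷ _ ([] ∷ _ , _ , _ , () ∷ _ , _)
  Factorisable-∷ {a} a≤b ((c ∷ v) ∷ ws , 2≤ , eq , νs , sorted) with refl ← ∷-injectiveˡ eq =
    (a ∷ []) ∷ (c ∷ v) ∷ ws , ≤-trans 2≤ (n≤1+n _) , cong (a ∷_) eq , tt ∷ νs ,
    ∷-mono-≤lex a≤b ([]-≤lex v) ∷ sorted

  Nyldon-∷⁻ : ∀ {a b} {u : Word m} → a ≤ᶠ b → Nyldon (a ∷ b ∷ u) → Nyldon (b ∷ u)
  Nyldon-∷⁻ {u = []} _ _ = tt
  Nyldon-∷⁻ {u = _ ∷ _} a≤b ν = ¬Factorisable⇒Nyldon (Nyldon⇒¬Factorisable ν ∘ Factorisable-∷ a≤b)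

  Nyldon-∷∷⇒> : ∀ {a b} {u : Word m} → Nyldon (a ∷ b ∷ u) → b <ᶠ a
  Nyldon-∷∷⇒> {a} {b} {u} ν with a ≤ᶠ? b
  ... | no a≰b = ≰⇒> a≰b
  ... | yes a≤b = ⊥-elim (Nyldon⇒¬Factorisable ν
        ( (a ∷ []) ∷ (b ∷ u) ∷ [] , s≤s (s≤s z≤n) , cong (a ∷_) (++-identityʳ (b ∷ u))
        , tt ∷ Nyldon-∷⁻ a≤b ν ∷ [] , ∷-mono-≤lex a≤b ([]-≤lex u) ∷ [-]))

  constant-Nyldon⇒[-] : ∀ {a} {u : Word m} → All (_≡ a) u → Nyldon u → u ≡ a ∷ []
  constant-Nyldon⇒[-] (refl ∷ []) _ = refl
  constant-Nyldon⇒[-] (refl ∷ refl ∷ _) ν = ⊥-elim (<-irrefl refl (Nyldon-∷∷⇒> ν))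

module _ (k : ℕ) where

  top next : Fin (suc (suc k))
  top = fromℕ (suc k)
  next = inject₁ (fromℕ k)

  next<top : next <ᶠ top
  next<top = ≤∧≢⇒< (≤fromℕ next) (fromℕ≢inject₁ ∘ sym)

  candidate : ℕ → Word (suc k)
  candidate j = top ∷ next ∷ replicate j top

  candidate-Nyldon : ∀ j → Nyldon (candidate j)
  candidate-Nyldon j = ¬Factorisable⇒Nyldon ¬factorisable
    where
    infix-constant : ∀ u v {w} → u ++ v ++ w ≡ replicate j top → All (_≡ top) v
    infix-constant u v eq = ++⁻ˡ v (++⁻ʳ u (subst (All (_≡ top)) (sym eq) (replicate⁺ j refl)))

    ¬factorisable : ¬ Factorisable (candidate j)
    ¬factorisable ([] ∷ _ , _ , _ , () ∷ _ , _)
    ¬factorisable (_ ∷ [] , s≤s () , _)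
    ¬factorisable ((c ∷ []) ∷ [] ∷ _ , _ , _ , _ ∷ () ∷ _ , _)
    ¬factorisable ((c ∷ []) ∷ (d ∷ v) ∷ _ , _ , eq , _ , c≤d ∷ _)
      with refl ← ∷-injectiveˡ eq | refl ← ∷-injectiveˡ (∷-injectiveʳ eq)
      = <⇒≱ next<top ([-]-≤lex⇒≤ c≤d)
    ¬factorisable ((c ∷ c′ ∷ u) ∷ v ∷ ws , _ , eq , _ ∷ νv ∷ _ , u≤v ∷ _)
      with refl ← ∷-injectiveˡ eq
      with refl ← constant-Nyldon⇒[-] (infix-constant u v (∷-injectiveʳ (∷-injectiveʳ eq))) νv
      with () ← ≤lex-[-]⇒≡[] u≤v

  Nyldon⇒≤lex-candidate : ∀ j (v : Word (suc k)) → Nyldon v → length v ≤ suc (suc j)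
                        → v ≤lex candidate j
  Nyldon⇒≤lex-candidate j (a ∷ []) _ _ = ∷-mono-≤lex (≤fromℕ a) ([]-≤lex _)
  Nyldon⇒≤lex-candidate j (a ∷ b ∷ u) ν (s≤s (s≤s u≤j)) =
    -- pred top reduces to next
    ∷-mono-≤lex (≤fromℕ a)
      (∷-mono-≤lex (<⇒≤pred (<-≤-trans (Nyldon-∷∷⇒> ν) (≤fromℕ a))) (≤lex-replicate-fromℕ j u u≤j))

lemma6p3 : (k j : ℕ) →
    let w : Word (suc k)
        w = fromℕ (suc k) ∷ inject₁ (fromℕ k) ∷ replicate j (fromℕ (suc k))
    in Nyldon w × length w ≤ suc (suc j)
       × ((v : Word (suc k)) → Nyldon v → length v ≤ suc (suc j) → v ≤lex w)
lemma6p3 k j =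
  candidate-Nyldon k j , s≤s (s≤s (≤-reflexive (length-replicate j))) , Nyldon⇒≤lex-candidate k j
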